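{- Let $G$ be a graph and $k\ge 1$ an integer. For any $i_{[kR]}$-function $f$ of $G$, with $V_j=\{v\in V(G): f(v)=j\}$, we have $|V_{k+1}|\le i_{[kR]}(G)-k\cdot i(G)$ and $|V_k|\ge (k+1)\,i(G)-i_{[kR]}(G)$.
   Context: All graphs are finite and simple. $i(G)$ is the minimum size of an independent dominating set of $G$. For $f\colon V(G)\to\mathbb{Z}_{\ge 0}$ and $S\subseteq V(G)$, $f(S)=\sum_{v\in S}f(v)$, and $AN(v)=\{w\in N(v): f(w)\ge 1\}$. A $[k]$-Roman dominating function of $G$ is a function $f\colon V(G)\to\{0,1,\ldots,k+1\}$ such that $f(N[v])\ge k+|AN(v)|$ for every vertex $v$ with $f(v)<k$; its weight is $f(V(G))$. An independent $[k]$-Roman dominating function is one whose set of vertices with positive label is independent (it only uses labels $0,k,k+1$); $i_{[kR]}(G)$ is the minimum weight of such a function, and an $i_{[kR]}$-function is one attaining it. -}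

module Defs where

open import Data.Nat using (ℕ; zero; suc; _+_; _*_; _≤_; _<_)
open import Data.Bool using (Bool; true; false; T; if_then_else_)
open import Data.Fin using (Fin)
open import Data.List using (List; map; filter; length)
open import Data.Nat.ListAction using (sum)
open import Data.Empty using (⊥)
open import Data.List.Base using (allFin)
open import Data.Product using (_×_; Σ; ∃; _,_)
open import Data.Sum using (_⊎_)
open import Relation.Binary.PropositionalEquality using (_≡_)
open import Relation.Nullary using (¬_)
open import Relation.Nullary.Decidable using (⌊_⌋)
import Data.Nat as ℕ

record Graph (n : ℕ) : Set where
  field
    adj   : Fin n → Fin n → Bool
    sym   : ∀ u v → adj u v ≡ adj v u
    irrefl : ∀ v → adj v v ≡ false
open Graph public

N : ∀ {n} → Graph n → Fin n → List (Fin n)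
N G v = filter (λ w → T? (adj G v w)) (allFin _)
  where
  open import Data.Bool.Properties using (T?)

fsum : ∀ {n} → (Fin n → ℕ) → List (Fin n) → ℕ
fsum f S = sum (map f S)

fN[_] : ∀ {n} → Graph n → (Fin n → ℕ) → Fin n → ℕ
fN[ G ] f v = f v + fsum f (N G v)

AN-size : ∀ {n} → Graph n → (Fin n → ℕ) → Fin n → ℕ
AN-size G f v = length (filter (λ w → 1 ℕ.≤? f w) (N G v))

weight : ∀ {n} → (Fin n → ℕ) → ℕ
weight f = fsum f (allFin _)

classSize : ∀ {n} → (Fin n → ℕ) → ℕ → ℕ
classSize f j = length (filter (λ v → f v ℕ.≟ j) (allFin _))

IsKRDF : ∀ {n} → ℕ → Graph n → (Fin n → ℕ) → Set
IsKRDF k G f =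
  (∀ v → f v ≤ suc k) ×
  (∀ v → f v < k → k + AN-size G f v ≤ fN[ G ] f v)

IsIKRDF : ∀ {n} → ℕ → Graph n → (Fin n → ℕ) → Set
IsIKRDF k G f =
  IsKRDF k G f ×
  (∀ u v → T (adj G u v) → 1 ≤ f u → 1 ≤ f v → ⊥)

IsIKR-function : ∀ {n} → ℕ → Graph n → (Fin n → ℕ) → Set
IsIKR-function k G f =
  IsIKRDF k G f × (∀ g → IsIKRDF k G g → weight f ≤ weight g)

Subset : ℕ → Set
Subset n = Fin n → Bool

size : ∀ {n} → Subset n → ℕ
size S = length (filter (λ v → T? (S v)) (allFin _))
  where
  open import Data.Bool.Properties using (T?)

IsIndependent : ∀ {n} → Graph n → Subset n → Set
IsIndependent G S = ∀ u v → T (S u) → T (S v) → ¬ T (adj G u v)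

IsDominating : ∀ {n} → Graph n → Subset n → Set
IsDominating G S = ∀ v → T (S v) ⊎ (Σ (Fin _) λ u → T (S u) × T (adj G u v))

IsIDS : ∀ {n} → Graph n → Subset n → Set
IsIDS G S = IsIndependent G S × IsDominating G S

IsIndepDomNumber : ∀ {n} → Graph n → ℕ → Set
IsIndepDomNumber G m =
  (Σ (Subset _) λ S → IsIDS G S × size S ≡ m) ×
  (∀ S → IsIDS G S → m ≤ size S)

IsIKRNumber : ∀ {n} → ℕ → Graph n → ℕ → Set
IsIKRNumber k G w =
  (Σ (Fin _ → ℕ) λ f → IsIKRDF k G f × weight f ≡ w) ×
  (∀ g → IsIKRDF k G g → w ≤ weight g)

{-# OPTIONS --safe #-}
-- An independent [k]-RDF f gives each labelled vertex only unlabelled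
-- neighbours, so f(N[v]) = f(v) there and a label below k would violate the
-- Roman condition: f takes only the values 0, k and k+1. Its support
-- S = V_k ∪ V_{k+1} is independent, and dominating because an unlabelled
-- vertex needs f(N(v)) ≥ k ≥ 1. Hence i(G) ≤ |S|, while for an
-- i_[kR]-function i_[kR](G) = f(V) = k|S| + |V_{k+1}| and |S| = |V_k| + |V_{k+1}|.
module Submission where

open import Defs hiding (sym)
open import Data.Nat using (ℕ; suc; _+_; _*_; _≤_)
open import Data.Fin using (Fin)
open import Data.Product using (_×_)

open import Algebra.Properties.CommutativeSemigroup using (interchange)
open import Data.Bool using (Bool; true; false; T; if_then_else_)
open import Data.Bool.Properties using (T?)
open import Data.Nat using (zero; _<_; z≤n; s≤s; _≟_; _≤?_; _<?_)
open import Data.Nat.Properties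
open import Data.Nat.ListAction using (sum)
open import Data.List using (List; []; _∷_; map; filter; length; allFin)
open import Data.List.Properties using (map-cong)
open import Data.List.Membership.Propositional using (_∈_)
open import Data.List.Membership.Propositional.Properties using (∈-filter⁻)
open import Data.List.Relation.Unary.Any using (here; there)
open import Data.Product using (Σ; _,_; proj₁; proj₂)
open import Data.Sum using (_⊎_; inj₁; inj₂; map₂)
open import Data.Empty using (⊥; ⊥-elim)
open import Function using (_∘_)
open import Relation.Nullary using (yes; no; does)
open import Relation.Nullary.Decidable using (dec-true; dec-false)
open import Relation.Unary using (Pred; Decidable)
open import Relation.Binary.PropositionalEquality
  using (_≡_; _≗_; refl; sym; cong; cong₂; subst; module ≡-Reasoning)

𝟙 : Bool → ℕ
𝟙 b = if b then 1 else 0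

module _ {a} {A : Set a} where

  length-filter≡sum-𝟙 : ∀ {p} {P : Pred A p} (P? : Decidable P) (xs : List A) →
    length (filter P? xs) ≡ sum (map (𝟙 ∘ does ∘ P?) xs)
  length-filter≡sum-𝟙 P? []       = refl
  length-filter≡sum-𝟙 P? (x ∷ xs) with does (P? x)
  ... | true  = cong suc (length-filter≡sum-𝟙 P? xs)
  ... | false = length-filter≡sum-𝟙 P? xs

  sum-map-cong : {f g : A → ℕ} → f ≗ g → (xs : List A) → sum (map f xs) ≡ sum (map g xs)
  sum-map-cong f≗g = cong sum ∘ map-cong f≗g

  sum-map-+ : (f g : A → ℕ) (xs : List A) →
    sum (map (λ x → f x + g x) xs) ≡ sum (map f xs) + sum (map g xs)
  sum-map-+ f g []       = refl
  sum-map-+ f g (x ∷ xs) = begin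
    (f x + g x) + sum (map (λ x → f x + g x) xs)
      ≡⟨ cong (f x + g x +_) (sum-map-+ f g xs) ⟩
    (f x + g x) + (sum (map f xs) + sum (map g xs))
      ≡⟨ interchange +-commutativeSemigroup (f x) (g x) _ _ ⟩
    (f x + sum (map f xs)) + (g x + sum (map g xs)) ∎
    where open ≡-Reasoning

  sum-map-*ˡ : (c : ℕ) (f : A → ℕ) (xs : List A) →
    sum (map (λ x → c * f x) xs) ≡ c * sum (map f xs)
  sum-map-*ˡ c f []       = sym (*-zeroʳ c)
  sum-map-*ˡ c f (x ∷ xs) = begin
    c * f x + sum (map (λ x → c * f x) xs) ≡⟨ cong (c * f x +_) (sum-map-*ˡ c f xs) ⟩
    c * f x + c * sum (map f xs)           ≡⟨ sym (*-distribˡ-+ c (f x) _) ⟩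
    c * (f x + sum (map f xs))             ∎
    where open ≡-Reasoning

  sum-map-≡0 : (f : A → ℕ) (xs : List A) → (∀ {x} → x ∈ xs → f x ≡ 0) → sum (map f xs) ≡ 0
  sum-map-≡0 f []       _  = refl
  sum-map-≡0 f (x ∷ xs) f≡0 = cong₂ _+_ (f≡0 (here refl)) (sum-map-≡0 f xs (f≡0 ∘ there))

  sum-map-positive : (f : A → ℕ) (xs : List A) → 1 ≤ sum (map f xs) →
    Σ A λ x → x ∈ xs × 1 ≤ f x
  sum-map-positive f []       ()
  sum-map-positive f (x ∷ xs) 1≤sum with f x in fx≡
  ... | suc _ = x , here refl , subst (1 ≤_) (sym fx≡) (s≤s z≤n)
  ... | zero  with y , y∈xs , 1≤fy ← sum-map-positive f xs 1≤sum = y , there y∈xs , 1≤fy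

data RomanLabel (k : ℕ) : ℕ → Set where
  unlabelled : RomanLabel k 0
  label-k    : RomanLabel k k
  label-1+k  : RomanLabel k (suc k)

romanLabel : ∀ {k ℓ} → ℓ ≤ suc k → ℓ ≡ 0 ⊎ k ≤ ℓ → RomanLabel k ℓ
romanLabel _     (inj₁ refl) = unlabelled
romanLabel ℓ≤1+k (inj₂ k≤ℓ)  with m≤n⇒m<n∨m≡n k≤ℓ
... | inj₂ refl = label-k
... | inj₁ k<ℓ  with refl ← ≤-antisym ℓ≤1+k k<ℓ = label-1+k

positive-𝟙-split : ∀ {k ℓ} → 1 ≤ k → RomanLabel k ℓ →
  𝟙 (does (1 ≤? ℓ)) ≡ 𝟙 (does (ℓ ≟ k)) + 𝟙 (does (ℓ ≟ suc k))
positive-𝟙-split {k} 1≤k unlabelled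
  rewrite dec-false (0 ≟ k) (<⇒≢ 1≤k) = refl
positive-𝟙-split {k} 1≤k label-k
  rewrite dec-true (1 ≤? k) 1≤k | dec-true (k ≟ k) refl | dec-false (k ≟ suc k) (1+n≢n ∘ sym) = refl
positive-𝟙-split {k} 1≤k label-1+k
  rewrite dec-false (suc k ≟ k) 1+n≢n | dec-true (suc k ≟ suc k) refl = refl

label-split : ∀ {k ℓ} → RomanLabel k ℓ → ℓ ≡ 𝟙 (does (ℓ ≟ suc k)) + k * 𝟙 (does (1 ≤? ℓ))
label-split {k} unlabelled = sym (*-zeroʳ k)
label-split {k} label-k
  rewrite dec-false (k ≟ suc k) (1+n≢n ∘ sym) = n≡n*𝟙[0<n] k
  where
  n≡n*𝟙[0<n] : ∀ n → n ≡ n * 𝟙 (does (1 ≤? n))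
  n≡n*𝟙[0<n] zero    = refl
  n≡n*𝟙[0<n] (suc n) = sym (*-identityʳ (suc n))
label-split {k} label-1+k
  rewrite dec-true (suc k ≟ suc k) refl = cong suc (sym (*-identityʳ k))

support : ∀ {n} → (Fin n → ℕ) → Subset n
support f v = does (1 ≤? f v)

module _ {n k} {f : Fin n → ℕ} (labels : ∀ v → RomanLabel k (f v)) where

  size-support : 1 ≤ k → size (support f) ≡ classSize f k + classSize f (suc k)
  size-support 1≤k = begin
    size (support f)
      ≡⟨ length-filter≡sum-𝟙 _ (allFin n) ⟩
    sum (map (𝟙 ∘ support f) (allFin n))
      ≡⟨ sum-map-cong (positive-𝟙-split 1≤k ∘ labels) (allFin n) ⟩
    sum (map (λ v → 𝟙 (does (f v ≟ k)) + 𝟙 (does (f v ≟ suc k))) (allFin n))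
      ≡⟨ sum-map-+ _ _ (allFin n) ⟩
    sum (map (λ v → 𝟙 (does (f v ≟ k))) (allFin n))
      + sum (map (λ v → 𝟙 (does (f v ≟ suc k))) (allFin n))
      ≡⟨ sym (cong₂ _+_ (length-filter≡sum-𝟙 _ (allFin n)) (length-filter≡sum-𝟙 _ (allFin n))) ⟩
    classSize f k + classSize f (suc k) ∎
    where open ≡-Reasoning

  weight-support : weight f ≡ classSize f (suc k) + k * size (support f)
  weight-support = begin
    weight f
      ≡⟨ sum-map-cong (label-split ∘ labels) (allFin n) ⟩
    sum (map (λ v → 𝟙 (does (f v ≟ suc k)) + k * 𝟙 (support f v)) (allFin n))
      ≡⟨ sum-map-+ _ _ (allFin n) ⟩
    sum (map (λ v → 𝟙 (does (f v ≟ suc k))) (allFin n))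
      + sum (map (λ v → k * 𝟙 (support f v)) (allFin n))
      ≡⟨ cong₂ _+_ (sym (length-filter≡sum-𝟙 _ (allFin n))) (sum-map-*ˡ k _ (allFin n)) ⟩
    classSize f (suc k) + k * sum (map (𝟙 ∘ support f) (allFin n))
      ≡⟨ cong (λ m → classSize f (suc k) + k * m) (sym (length-filter≡sum-𝟙 _ (allFin n))) ⟩
    classSize f (suc k) + k * size (support f) ∎
    where open ≡-Reasoning

module IndependentRomanDomination {n} (G : Graph n) {k} {f : Fin n → ℕ} (f-ikrdf : IsIKRDF k G f) where

  private
    bounded : ∀ v → f v ≤ suc k
    bounded = proj₁ (proj₁ f-ikrdf)

    roman : ∀ v → f v < k → k + AN-size G f v ≤ fN[ G ] f v
    roman = proj₂ (proj₁ f-ikrdf)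

    labelled-independent : ∀ u v → T (adj G u v) → 1 ≤ f u → 1 ≤ f v → ⊥
    labelled-independent = proj₂ f-ikrdf

  adjacent : ∀ {v w} → w ∈ N G v → T (adj G v w)
  adjacent {v} = proj₂ ∘ ∈-filter⁻ (λ w → T? (adj G v w)) {xs = allFin n}

  labelled⇒neighbours-unlabelled : ∀ {v w} → 1 ≤ f v → w ∈ N G v → f w ≡ 0
  labelled⇒neighbours-unlabelled {v} {w} 1≤fv w∈N with 1 ≤? f w
  ... | yes 1≤fw = ⊥-elim (labelled-independent v w (adjacent w∈N) 1≤fv 1≤fw)
  ... | no  1≰fw = n<1⇒n≡0 (≰⇒> 1≰fw)

  labelled⇒≥k : ∀ {v} → 1 ≤ f v → k ≤ f v
  labelled⇒≥k {v} 1≤fv with f v <? k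
  ... | no  fv≮k = ≮⇒≥ fv≮k
  ... | yes fv<k = begin
    k                           ≤⟨ m≤m+n k _ ⟩
    k + AN-size G f v           ≤⟨ roman v fv<k ⟩
    f v + fsum f (N G v)        ≡⟨ cong (f v +_) (sum-map-≡0 f (N G v) (labelled⇒neighbours-unlabelled 1≤fv)) ⟩
    f v + 0                     ≡⟨ +-identityʳ (f v) ⟩
    f v                         ∎
    where open ≤-Reasoning

  labels : ∀ v → RomanLabel k (f v)
  labels v = romanLabel (bounded v) (map₂ labelled⇒≥k (zero-or-positive (f v)))
    where
    zero-or-positive : ∀ m → m ≡ 0 ⊎ 1 ≤ m
    zero-or-positive zero    = inj₁ refl
    zero-or-positive (suc m) = inj₂ (s≤s z≤n)

  unlabelled⇒labelled-neighbour : 1 ≤ k → ∀ {v} → f v ≡ 0 → Σ (Fin n) λ w → w ∈ N G v × 1 ≤ f w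
  unlabelled⇒labelled-neighbour 1≤k {v} fv≡0 = sum-map-positive f (N G v) (begin
    1                      ≤⟨ 1≤k ⟩
    k                      ≤⟨ m≤m+n k _ ⟩
    k + AN-size G f v      ≤⟨ roman v (subst (_< k) (sym fv≡0) 1≤k) ⟩
    f v + fsum f (N G v)   ≡⟨ cong (_+ fsum f (N G v)) fv≡0 ⟩
    fsum f (N G v)         ∎)
    where open ≤-Reasoning

  -- T (support f v) computes to T (1 ≤ᵇ f v), hence ≤ᵇ⇒≤ and ≤⇒≤ᵇ below.
  support-isIDS : 1 ≤ k → IsIDS G (support f)
  support-isIDS 1≤k = independent , dominating
    where
    independent : IsIndependent G (support f)
    independent u v u∈S v∈S u~v = labelled-independent u v u~v (≤ᵇ⇒≤ 1 (f u) u∈S) (≤ᵇ⇒≤ 1 (f v) v∈S)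

    dominating : IsDominating G (support f)
    dominating v with 1 ≤? f v
    ... | yes 1≤fv = inj₁ (≤⇒≤ᵇ 1≤fv)
    ... | no  1≰fv with w , w∈N , 1≤fw ← unlabelled⇒labelled-neighbour 1≤k (n<1⇒n≡0 (≰⇒> 1≰fv))
      = inj₂ (w , ≤⇒≤ᵇ 1≤fw , subst T (Graph.sym G v w) (adjacent w∈N))

lemma4p3 : ∀ {n} (G : Graph n) (k : ℕ) → 1 ≤ k →
    (f : Fin n → ℕ) → IsIKR-function k G f →
    (i ikR : ℕ) → IsIndepDomNumber G i → IsIKRNumber k G ikR →
    (classSize f (suc k) + k * i ≤ ikR) ×
    ((suc k) * i ≤ classSize f k + ikR)
lemma4p3 G k 1≤k f (f-ikrdf , f-minimal) i ikR (_ , i-minimal) ((g , g-ikrdf , weight-g) , _) =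
  |V₁₊ₖ|+ki≤ikR , [1+k]i≤|Vₖ|+ikR
  where
  open IndependentRomanDomination G f-ikrdf
  open ≤-Reasoning
  s : ℕ
  s = size (support f)
  i≤s : i ≤ s
  i≤s = i-minimal (support f) (support-isIDS 1≤k)
  weight-f≤ikR : weight f ≤ ikR
  weight-f≤ikR = subst (weight f ≤_) weight-g (f-minimal g g-ikrdf)
  |V₁₊ₖ|+ki≤ikR : classSize f (suc k) + k * i ≤ ikR
  |V₁₊ₖ|+ki≤ikR = begin
    classSize f (suc k) + k * i ≤⟨ +-monoʳ-≤ _ (*-monoʳ-≤ k i≤s) ⟩
    classSize f (suc k) + k * s ≡⟨ weight-support labels ⟨
    weight f                    ≤⟨ weight-f≤ikR ⟩
    ikR                         ∎
  [1+k]i≤|Vₖ|+ikR : suc k * i ≤ classSize f k + ikR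
  [1+k]i≤|Vₖ|+ikR = begin
    suc k * i                                           ≤⟨ *-monoʳ-≤ (suc k) i≤s ⟩
    s + k * s                                           ≡⟨ cong (_+ k * s) (size-support labels 1≤k) ⟩
    classSize f k + classSize f (suc k) + k * s         ≡⟨ +-assoc (classSize f k) _ _ ⟩
    classSize f k + (classSize f (suc k) + k * s)       ≡⟨ cong (classSize f k +_) (weight-support labels) ⟨
    classSize f k + weight f                            ≤⟨ +-monoʳ-≤ (classSize f k) weight-f≤ikR ⟩
    classSize f k + ikR                                 ∎
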